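{- Let $r\geq 0$ and $m\geq 1$ be integers, let $n\geq 1$ be an integer, and put $N_r = n+\frac{r}{2}$. Then $$S_m^{(r)}(n) = S_1^{(r)}(n)\,\frac{(-1)^{m-1}}{(r+2)^{\overline{m-1}}}\,\det H_m^{(r)}(N_r),$$ where $H_m^{(r)}(N_r)$ is the $(m-1)\times(m-1)$ lower Hessenberg matrix whose entries $h_{i,k}$ ($1\le i,k\le m-1$) are $$h_{i,k} = \begin{cases} r\binom{i+1}{k} B_{i+1-k}, & k<i,\\ -(i+1)N_r, & k=i,\\ r+i+1, & k=i+1,\\ 0, & k>i+1.\end{cases}$$ Explicitly, its first row is $(-2N_r,\ r+2,\ 0,\dots,0)$, its second row is $(r\binom{3}{1}B_2,\ -3N_r,\ r+3,\ 0,\dots,0)$, and its last row is $(r\binom{m}{1}B_{m-1},\ r\binom{m}{2}B_{m-2},\ \dots,\ r\binom{m}{m-2}B_2,\ -mN_r)$. For $m=1$ the determinant of the empty ($0\times 0$) matrix is taken to be $1$.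
   Context: For integers $m,r\geq 0$ and $n\geq 1$, the hyper-sums of powers of integers are defined recursively by $S_m^{(0)}(n)=n^m$ and $S_m^{(r)}(n)=\sum_{i=1}^n S_m^{(r-1)}(i)$ for $r\geq 1$. (In particular $S_1^{(r)}(n)=\binom{n+r}{r+1}$.) The rising factorial is $x^{\overline{k}}=x(x+1)\cdots(x+k-1)$ with $x^{\overline{0}}=1$. The $B_j$ are the Bernoulli numbers, $B_0=1$, $B_1=-\frac12$, $B_2=\frac16$, $B_3=0,\dots$, given by $\frac{t}{e^t-1}=\sum_{j\ge0}B_j\frac{t^j}{j!}$. -}

module Defs where

open import Data.Nat as ℕ using (ℕ; zero; suc; _+_; _*_; _∸_; _^_; NonZero; compare; less; equal; greater)
open import Data.Nat.Properties using (m*n≢0)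
open import Data.Nat.Combinatorics using (_C_)
open import Data.Integer using (+_)
open import Data.Fin using (Fin; toℕ; punchIn)
import Data.Fin as Fin
open import Data.List using (List; []; _∷_; _++_; [_]; upTo; zip; foldr)
open import Data.Product using (_,_)
open import Data.Rational using (ℚ; 0ℚ; 1ℚ; _/_; -_) renaming (_+_ to _+ℚ_; _*_ to _*ℚ_)

ℕ→ℚ : ℕ → ℚ
ℕ→ℚ k = (+ k) / 1

sumTo : (ℕ → ℕ) → ℕ → ℕ
sumTo f zero    = 0
sumTo f (suc n) = sumTo f n + f (suc n)

hyperSum : ℕ → ℕ → ℕ → ℕ
hyperSum m zero    n = n ^ m
hyperSum m (suc r) n = sumTo (hyperSum m r) n

rising : ℕ → ℕ → ℕ
rising x zero    = 1
rising x (suc k) = rising x k * (x + k)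

rising-nonZero : ∀ x k → NonZero (rising (suc x) k)
rising-nonZero x zero    = _
rising-nonZero x (suc k) = m*n≢0 (rising (suc x) k) (suc x + k) {{rising-nonZero x k}}

negOnePow : ℕ → ℚ
negOnePow zero    = 1ℚ
negOnePow (suc k) = - negOnePow k

-- Bernoulli numbers (B_1 = -1/2), via the recurrence
-- B_0 = 1,  B_j = -1/(j+1) Σ_{k=0}^{j-1} C(j+1,k) B_k.
-- bernUpTo j = [B_0, ..., B_j]
bernUpTo : ℕ → List ℚ
bernUpTo zero    = 1ℚ ∷ []
bernUpTo (suc j) = bs ++ [ - (((+ 1) / (2 + j)) *ℚ s) ]
  where
  bs : List ℚ
  bs = bernUpTo j
  s : ℚ
  s = foldr (λ { (k , b) acc → ℕ→ℚ ((2 + j) C k) *ℚ b +ℚ acc }) 0ℚ (zip (upTo (suc j)) bs)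

lastOr : ℚ → List ℚ → ℚ
lastOr d []       = d
lastOr d (x ∷ xs) = lastOr x xs

B : ℕ → ℚ
B j = lastOr 0ℚ (bernUpTo j)

sumFin : (n : ℕ) → (Fin n → ℚ) → ℚ
sumFin zero    f = 0ℚ
sumFin (suc n) f = f Fin.zero +ℚ sumFin n (λ i → f (Fin.suc i))

det : (n : ℕ) → (Fin n → Fin n → ℚ) → ℚ
det zero    M = 1ℚ
det (suc n) M = sumFin (suc n) (λ j →
  negOnePow (toℕ j) *ℚ M Fin.zero j *ℚ det n (λ a b → M (Fin.suc a) (punchIn j b)))

-- entry h_{i,k} (1-based indices i, k) of H_m^{(r)}(N)
hEntry : ℕ → ℚ → ℕ → ℕ → ℚ
hEntry r N i k with compare i k
... | less _ zero      = ℕ→ℚ (r + i + 1)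
... | less _ (suc _)   = 0ℚ
... | equal _          = - (ℕ→ℚ (i + 1) *ℚ N)
... | greater _ _      = ℕ→ℚ (r * ((i + 1) C k)) *ℚ B (i + 1 ∸ k)

H : ℕ → ℚ → (s : ℕ) → Fin s → Fin s → ℚ
H r N s i k = hEntry r N (suc (toℕ i)) (suc (toℕ k))

Nr : ℕ → ℕ → ℚ
Nr r n = (+ (2 * n + r)) / 2

module Submission where

-- Write Sₖ for Sₖ⁽ʳ⁾(n) and B⁺ for the Bernoulli numbers with B⁺₁ = +1/2. Faulhaber's formula
-- Σ_{k=1}^{p} C(p,k) B⁺_{p-k} nᵏ = p S_{p-1}⁽¹⁾(n) lifts, by induction along the recursion
-- S⁽ʳ⁺¹⁾(n+1) = S⁽ʳ⁺¹⁾(n) + S⁽ʳ⁾(n+1), to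
--   Σ_{k=1}^{p} C(p,k) B⁺_{p-k} Sₖ⁽ʳ⁾(n) = p S_{p-1}⁽ʳ⁺¹⁾(n).
-- Combined once more with that recursion it yields, for every w, the linear relation
--   r Σ_{b<w} C(w+2,b+1) B_{w+1-b} S_{b+1} - (w+2) N_r S_{w+1} + (r+w+2) S_{w+2} = 0,
-- which is row w+1 of H applied to (S₁, S₂, …). So (S₁, …, Sₘ) solves a lower Hessenberg system
-- with superdiagonal r+2, …, r+m, and Cramer's rule for such systems gives
--   det H · S₁ = (-1)ᵐ⁻¹ (r+2)(r+3)⋯(r+m) Sₘ.

open import Defs
open import Data.Nat as ℕ
  using (ℕ; zero; suc; _!; _∸_; _≤_; s≤s; z≤n; compare; less; equal; greater)
import Data.Nat.Properties as ℕP
open import Data.Nat.Combinatorics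
  using ( _C_; nCk≡n!/k![n-k]!; k![n∸k]!∣n!; k>n⇒nCk≡0; nCk+nC[k+1]≡[n+1]C[k+1]
        ; nCk≡nC[n∸k]; nC1≡n; nCn≡1)
open import Data.Nat.DivMod using (m/n*n≡m)
import Data.Nat.Coprimality as Coprime
import Data.Nat.Solver
import Data.Integer as ℤ
import Data.Integer.Properties as ℤP
open import Data.Rational using (ℚ; mkℚ; _/_; ½; 0ℚ; 1ℚ; _+_; _*_; -_; _-_)
import Data.Rational.Properties as ℚP
import Data.Rational.Solver
open import Data.Fin as Fin using (Fin; toℕ; punchIn)
open import Data.List using (List; []; _∷_; _++_; [_]; foldr; zip; applyUpTo; upTo)
import Data.List.Properties as ListP
open import Data.Product using (_×_; _,_; ∃-syntax)
open import Relation.Binary.PropositionalEquality hiding ([_])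
open import Algebra.Properties.Group ℚP.+-0-group
  using (x∙y⁻¹≈ε⇒x≈y; x≈y⇒x∙y⁻¹≈ε) renaming (∙-cancelˡ to +-cancelˡ)
open Data.Rational.Solver.+-*-Solver
open Data.Nat.Solver.+-*-Solver using () renaming (solve to solveℕ; _:*_ to _⊛_; _:=_ to _⊜_)
open ≡-Reasoning

ℕ→ℚ≡mkℚ : ∀ k → ℕ→ℚ k ≡ mkℚ (ℤ.+ k) 0 (Coprime.sym (Coprime.1-coprimeTo k))
ℕ→ℚ≡mkℚ k = ℚP.normalize-coprime (Coprime.sym (Coprime.1-coprimeTo k))

ℕ→ℚ-+ : ∀ a b → ℕ→ℚ (a ℕ.+ b) ≡ ℕ→ℚ a + ℕ→ℚ b
ℕ→ℚ-+ a b rewrite ℕ→ℚ≡mkℚ a | ℕ→ℚ≡mkℚ b =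
  ℚP./-cong (cong₂ ℤ._+_ (sym (ℤP.*-identityʳ (ℤ.+ a))) (sym (ℤP.*-identityʳ (ℤ.+ b)))) refl

ℕ→ℚ-* : ∀ a b → ℕ→ℚ (a ℕ.* b) ≡ ℕ→ℚ a * ℕ→ℚ b
ℕ→ℚ-* a b rewrite ℕ→ℚ≡mkℚ a | ℕ→ℚ≡mkℚ b = ℚP./-cong (ℤP.pos-* a b) refl

ℕ→ℚ-suc : ∀ n → ℕ→ℚ (suc n) ≡ ℕ→ℚ n + 1ℚ
ℕ→ℚ-suc n = trans (cong ℕ→ℚ (ℕP.+-comm 1 n)) (ℕ→ℚ-+ n 1)

1/n*n≡1 : ∀ n .{{_ : ℕ.NonZero n}} → ((ℤ.+ 1) / n) * ℕ→ℚ n ≡ 1ℚ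
1/n*n≡1 (suc k)
  rewrite ℕ→ℚ≡mkℚ (suc k) | ℚP.normalize-coprime {1} {k} (Coprime.1-coprimeTo (suc k)) =
  ℚP.*-inverseˡ (mkℚ (ℤ.+ suc k) 0 (Coprime.sym (Coprime.1-coprimeTo (suc k))))

m/2≡m*½ : ∀ m → (ℤ.+ m) / 2 ≡ ℕ→ℚ m * ½
m/2≡m*½ m rewrite ℕ→ℚ≡mkℚ m = ℚP./-cong (sym (ℤP.*-identityʳ (ℤ.+ m))) refl

infixr 8 _^_

_^_ : ℚ → ℕ → ℚ
x ^ zero  = 1ℚ
x ^ suc k = x * x ^ k

ℕ→ℚ-^ : ∀ a k → ℕ→ℚ (a ℕ.^ k) ≡ ℕ→ℚ a ^ k
ℕ→ℚ-^ a zero    = refl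
ℕ→ℚ-^ a (suc k) = trans (ℕ→ℚ-* a (a ℕ.^ k)) (cong (ℕ→ℚ a *_) (ℕ→ℚ-^ a k))

∑ : ℕ → (ℕ → ℚ) → ℚ
∑ zero    f = 0ℚ
∑ (suc n) f = ∑ n f + f n

syntax ∑ n (λ k → e) = ∑[ k < n ] e

∑-cong-< : ∀ {f g} n → (∀ k → k ℕ.< n → f k ≡ g k) → ∑ n f ≡ ∑ n g
∑-cong-< zero    f≡g = refl
∑-cong-< (suc n) f≡g =
  cong₂ _+_ (∑-cong-< n (λ k k<n → f≡g k (ℕP.m<n⇒m<1+n k<n))) (f≡g n ℕP.≤-refl)

∑-cong : ∀ {f g} n → (∀ k → f k ≡ g k) → ∑ n f ≡ ∑ n g
∑-cong n f≡g = ∑-cong-< n (λ k _ → f≡g k)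

∑-zero : ∀ {f} n → (∀ k → k ℕ.< n → f k ≡ 0ℚ) → ∑ n f ≡ 0ℚ
∑-zero zero    f≡0 = refl
∑-zero (suc n) f≡0 =
  cong₂ _+_ (∑-zero n (λ k k<n → f≡0 k (ℕP.m<n⇒m<1+n k<n))) (f≡0 n ℕP.≤-refl)

∑-distrib-+ : ∀ f g n → ∑[ k < n ] (f k + g k) ≡ ∑ n f + ∑ n g
∑-distrib-+ f g zero    = refl
∑-distrib-+ f g (suc n) rewrite ∑-distrib-+ f g n =
  solve 4 (λ a b c d → (a :+ b) :+ (c :+ d) := (a :+ c) :+ (b :+ d)) refl (∑ n f) (∑ n g) (f n) (g n)

*-distribˡ-∑ : ∀ c f n → c * ∑ n f ≡ ∑[ k < n ] (c * f k)
*-distribˡ-∑ c f zero    = ℚP.*-zeroʳ c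
*-distribˡ-∑ c f (suc n) rewrite sym (*-distribˡ-∑ c f n) = ℚP.*-distribˡ-+ c (∑ n f) (f n)

*-distribʳ-∑ : ∀ c f n → ∑ n f * c ≡ ∑[ k < n ] (f k * c)
*-distribʳ-∑ c f zero    = ℚP.*-zeroˡ c
*-distribʳ-∑ c f (suc n) rewrite sym (*-distribʳ-∑ c f n) = ℚP.*-distribʳ-+ c (∑ n f) (f n)

∑-head : ∀ f n → ∑ (suc n) f ≡ f 0 + ∑[ k < n ] f (suc k)
∑-head f zero    = ℚP.+-comm 0ℚ (f 0)
∑-head f (suc n) rewrite ∑-head f n = ℚP.+-assoc (f 0) (∑[ k < n ] f (suc k)) (f (suc n))

∑-split : ∀ f a b → ∑ (a ℕ.+ b) f ≡ ∑ a f + ∑[ t < b ] f (a ℕ.+ t)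
∑-split f a zero    rewrite ℕP.+-identityʳ a = sym (ℚP.+-identityʳ (∑ a f))
∑-split f a (suc b) rewrite ℕP.+-suc a b | ∑-split f a b =
  ℚP.+-assoc (∑ a f) (∑[ t < b ] f (a ℕ.+ t)) (f (a ℕ.+ b))

∑-comm : ∀ (g : ℕ → ℕ → ℚ) n m → ∑[ k < n ] ∑[ l < m ] g k l ≡ ∑[ l < m ] ∑[ k < n ] g k l
∑-comm g zero    m = sym (∑-zero m (λ _ _ → refl))
∑-comm g (suc n) m rewrite ∑-comm g n m = sym (∑-distrib-+ (λ l → ∑[ k < n ] g k l) (g n) m)

∑-reverse : ∀ f n → ∑ n f ≡ ∑[ t < n ] f (n ∸ suc t)
∑-reverse f zero    = refl
∑-reverse f (suc n) = begin
  ∑ n f + f n                       ≡⟨ cong (_+ f n) (∑-reverse f n) ⟩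
  ∑[ t < n ] f (n ∸ suc t) + f n    ≡⟨ ℚP.+-comm _ (f n) ⟩
  f n + ∑[ t < n ] f (n ∸ suc t)    ≡⟨ ∑-head (λ t → f (suc n ∸ suc t)) n ⟨
  ∑[ t < suc n ] f (suc n ∸ suc t)  ∎

∏ : ℕ → (ℕ → ℚ) → ℚ
∏ zero    c = 1ℚ
∏ (suc n) c = c 0 * ∏ n (λ a → c (suc a))

∏-cong : ∀ {c d} n → (∀ a → c a ≡ d a) → ∏ n c ≡ ∏ n d
∏-cong zero    c≡d = refl
∏-cong (suc n) c≡d = cong₂ _*_ (c≡d 0) (∏-cong n (λ a → c≡d (suc a)))

Cℚ : ℕ → ℕ → ℚ
Cℚ n k = ℕ→ℚ (n C k)

nCk*k!*[n∸k]!≡n! : ∀ {n k} → k ≤ n → (n C k) ℕ.* (k ! ℕ.* (n ∸ k) !) ≡ n !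
nCk*k!*[n∸k]!≡n! {n} {k} k≤n =
  trans (cong (ℕ._* (k ! ℕ.* (n ∸ k) !)) (nCk≡n!/k![n-k]! k≤n))
        (m/n*n≡m {{k ℕP.!* (n ∸ k) !≢0}} (k![n∸k]!∣n! k≤n))

[m+n]Cm*m!*n!≡[m+n]! : ∀ m n → ((m ℕ.+ n) C m) ℕ.* (m ! ℕ.* n !) ≡ (m ℕ.+ n) !
[m+n]Cm*m!*n!≡[m+n]! m n = subst (λ k → ((m ℕ.+ n) C m) ℕ.* (m ! ℕ.* k !) ≡ (m ℕ.+ n) !)
                                 (ℕP.m+n∸m≡n m n) (nCk*k!*[n∸k]!≡n! (ℕP.m≤m+n m n))

C-trinomial : ∀ a b c →
  ((a ℕ.+ b ℕ.+ c) C (a ℕ.+ b)) ℕ.* ((a ℕ.+ b) C a) ≡ ((a ℕ.+ (b ℕ.+ c)) C a) ℕ.* ((b ℕ.+ c) C b)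
C-trinomial a b c = ℕP.*-cancelʳ-≡ _ _ (a ! ℕ.* (b ! ℕ.* c !)) {{a!b!c!≢0}} (trans lhs (sym rhs))
  where
  a!b!c!≢0 = ℕP.m*n≢0 (a !) (b ! ℕ.* c !) {{a ℕP.!≢0}} {{b ℕP.!* c !≢0}}
  X = (a ℕ.+ b ℕ.+ c) C (a ℕ.+ b)
  Y = (a ℕ.+ b) C a
  P = (a ℕ.+ (b ℕ.+ c)) C a
  Q = (b ℕ.+ c) C b
  lhs : X ℕ.* Y ℕ.* (a ! ℕ.* (b ! ℕ.* c !)) ≡ (a ℕ.+ b ℕ.+ c) !
  lhs = begin
    X ℕ.* Y ℕ.* (a ! ℕ.* (b ! ℕ.* c !))
      ≡⟨ solveℕ 5 (λ X Y x y z → X ⊛ Y ⊛ (x ⊛ (y ⊛ z)) ⊜ X ⊛ ((Y ⊛ (x ⊛ y)) ⊛ z))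
                refl X Y (a !) (b !) (c !) ⟩
    X ℕ.* ((Y ℕ.* (a ! ℕ.* b !)) ℕ.* c !)
      ≡⟨ cong (λ u → X ℕ.* (u ℕ.* c !)) ([m+n]Cm*m!*n!≡[m+n]! a b) ⟩
    X ℕ.* ((a ℕ.+ b) ! ℕ.* c !)
      ≡⟨ [m+n]Cm*m!*n!≡[m+n]! (a ℕ.+ b) c ⟩
    (a ℕ.+ b ℕ.+ c) ! ∎
  rhs : P ℕ.* Q ℕ.* (a ! ℕ.* (b ! ℕ.* c !)) ≡ (a ℕ.+ b ℕ.+ c) !
  rhs = begin
    P ℕ.* Q ℕ.* (a ! ℕ.* (b ! ℕ.* c !))
      ≡⟨ solveℕ 5 (λ P Q x y z → P ⊛ Q ⊛ (x ⊛ (y ⊛ z)) ⊜ P ⊛ (x ⊛ (Q ⊛ (y ⊛ z))))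
                refl P Q (a !) (b !) (c !) ⟩
    P ℕ.* (a ! ℕ.* (Q ℕ.* (b ! ℕ.* c !)))
      ≡⟨ cong (λ u → P ℕ.* (a ! ℕ.* u)) ([m+n]Cm*m!*n!≡[m+n]! b c) ⟩
    P ℕ.* (a ! ℕ.* (b ℕ.+ c) !)
      ≡⟨ [m+n]Cm*m!*n!≡[m+n]! a (b ℕ.+ c) ⟩
    (a ℕ.+ (b ℕ.+ c)) !
      ≡⟨ cong _! (ℕP.+-assoc a b c) ⟨
    (a ℕ.+ b ℕ.+ c) ! ∎

C-absorption : ∀ l q → ((l ℕ.+ q) C l) ℕ.* q ≡ (l ℕ.+ q) ℕ.* ((l ℕ.+ q ∸ 1) C l)
C-absorption zero    zero    = refl
C-absorption (suc l) zero    rewrite ℕP.+-identityʳ l | k>n⇒nCk≡0 (ℕP.n<1+n l) =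
  trans (ℕP.*-zeroʳ (suc l C suc l)) (sym (ℕP.*-zeroʳ (suc l)))
C-absorption l       (suc u) =
  ℕP.*-cancelʳ-≡ _ _ (l ! ℕ.* u !) {{l ℕP.!* u !≢0}} (trans lhs (sym rhs))
  where
  X = (l ℕ.+ suc u) C l
  lhs : X ℕ.* suc u ℕ.* (l ! ℕ.* u !) ≡ (l ℕ.+ suc u) !
  lhs = trans (solveℕ 4 (λ X s x y → X ⊛ s ⊛ (x ⊛ y) ⊜ X ⊛ (x ⊛ (s ⊛ y))) refl X (suc u) (l !) (u !))
              ([m+n]Cm*m!*n!≡[m+n]! l (suc u))
  rhs : (l ℕ.+ suc u) ℕ.* ((l ℕ.+ suc u ∸ 1) C l) ℕ.* (l ! ℕ.* u !) ≡ (l ℕ.+ suc u) !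
  rhs rewrite ℕP.+-suc l u = begin
    suc (l ℕ.+ u) ℕ.* ((l ℕ.+ u) C l) ℕ.* (l ! ℕ.* u !)
      ≡⟨ ℕP.*-assoc (suc (l ℕ.+ u)) ((l ℕ.+ u) C l) (l ! ℕ.* u !) ⟩
    suc (l ℕ.+ u) ℕ.* (((l ℕ.+ u) C l) ℕ.* (l ! ℕ.* u !))
      ≡⟨ cong (suc (l ℕ.+ u) ℕ.*_) ([m+n]Cm*m!*n!≡[m+n]! l u) ⟩
    suc (l ℕ.+ u) ! ∎

binomial : ∀ x k N → k ℕ.< N → (x + 1ℚ) ^ k ≡ ∑[ l < N ] (Cℚ k l * x ^ l)
binomial x zero    (suc N) _ = begin
  1ℚ
    ≡⟨ ℚP.+-identityʳ 1ℚ ⟨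
  1ℚ + 0ℚ
    ≡⟨ cong (1ℚ +_) (∑-zero N (λ l _ → ℚP.*-zeroˡ (x ^ suc l))) ⟨
  Cℚ 0 0 * x ^ 0 + ∑[ l < N ] (Cℚ 0 (suc l) * x ^ suc l)
    ≡⟨ ∑-head (λ l → Cℚ 0 l * x ^ l) N ⟨
  ∑[ l < suc N ] (Cℚ 0 l * x ^ l) ∎
binomial x (suc k) (suc N) (s≤s k<N) = begin
  (x + 1ℚ) * (x + 1ℚ) ^ k
    ≡⟨ cong ((x + 1ℚ) *_) (binomial x k (suc N) (ℕP.m<n⇒m<1+n k<N)) ⟩
  (x + 1ℚ) * A
    ≡⟨ solve 2 (λ x A → (x :+ con 1ℚ) :* A := x :* A :+ A) refl x A ⟩
  x * A + A
    ≡⟨ cong₂ _+_ xA (∑-head (λ l → Cℚ k l * x ^ l) N) ⟩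
  (S₁ + Cℚ k N * x ^ suc N) + (1ℚ * 1ℚ + S₂)
    ≡⟨ cong (λ c → (S₁ + ℕ→ℚ c * x ^ suc N) + (1ℚ * 1ℚ + S₂)) (k>n⇒nCk≡0 k<N) ⟩
  (S₁ + 0ℚ * x ^ suc N) + (1ℚ * 1ℚ + S₂)
    ≡⟨ solve 3 (λ S₁ y S₂ → (S₁ :+ con 0ℚ :* y) :+ (con 1ℚ :* con 1ℚ :+ S₂)
                            := con 1ℚ :* con 1ℚ :+ (S₁ :+ S₂)) refl S₁ (x ^ suc N) S₂ ⟩
  1ℚ * 1ℚ + (S₁ + S₂)
    ≡⟨ cong (1ℚ * 1ℚ +_) (∑-distrib-+ _ _ N) ⟨
  1ℚ * 1ℚ + ∑[ l < N ] (Cℚ k l * x ^ suc l + Cℚ k (suc l) * x ^ suc l)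
    ≡⟨ cong (1ℚ * 1ℚ +_) (∑-cong N pascal) ⟩
  Cℚ (suc k) 0 * x ^ 0 + ∑[ l < N ] (Cℚ (suc k) (suc l) * x ^ suc l)
    ≡⟨ ∑-head (λ l → Cℚ (suc k) l * x ^ l) N ⟨
  ∑[ l < suc N ] (Cℚ (suc k) l * x ^ l) ∎
  where
  A  = ∑[ l < suc N ] (Cℚ k l * x ^ l)
  S₁ = ∑[ l < N ] (Cℚ k l * x ^ suc l)
  S₂ = ∑[ l < N ] (Cℚ k (suc l) * x ^ suc l)
  xA : x * A ≡ S₁ + Cℚ k N * x ^ suc N
  xA = trans (*-distribˡ-∑ x _ (suc N)) (∑-cong (suc N) (λ l →
         solve 3 (λ x c y → x :* (c :* y) := c :* (x :* y)) refl x (Cℚ k l) (x ^ l)))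
  pascal : ∀ l → Cℚ k l * x ^ suc l + Cℚ k (suc l) * x ^ suc l ≡ Cℚ (suc k) (suc l) * x ^ suc l
  pascal l = begin
    Cℚ k l * x ^ suc l + Cℚ k (suc l) * x ^ suc l
      ≡⟨ ℚP.*-distribʳ-+ (x ^ suc l) (Cℚ k l) (Cℚ k (suc l)) ⟨
    (Cℚ k l + Cℚ k (suc l)) * x ^ suc l
      ≡⟨ cong (_* x ^ suc l) (ℕ→ℚ-+ (k C l) (k C suc l)) ⟨
    ℕ→ℚ (k C l ℕ.+ k C suc l) * x ^ suc l
      ≡⟨ cong (λ c → ℕ→ℚ c * x ^ suc l) (nCk+nC[k+1]≡[n+1]C[k+1] k l) ⟩
    Cℚ (suc k) (suc l) * x ^ suc l ∎

-- Bernoulli numbers and Faulhaber's formula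

lastOr-∷ʳ : ∀ d (xs : List ℚ) x → lastOr d (xs ++ [ x ]) ≡ x
lastOr-∷ʳ d []       x = refl
lastOr-∷ʳ d (y ∷ xs) x = lastOr-∷ʳ y xs x

bernUpTo≡applyUpTo-B : ∀ j → bernUpTo j ≡ applyUpTo B (suc j)
bernUpTo≡applyUpTo-B zero    = refl
bernUpTo≡applyUpTo-B (suc j) = begin
  bernUpTo (suc j)                     ≡⟨ cong (λ y → bernUpTo j ++ [ y ]) (lastOr-∷ʳ 0ℚ (bernUpTo j) _) ⟨
  bernUpTo j ++ [ B (suc j) ]          ≡⟨ cong (_++ [ B (suc j) ]) (bernUpTo≡applyUpTo-B j) ⟩
  applyUpTo B (suc j) ++ [ B (suc j) ] ≡⟨ ListP.applyUpTo-∷ʳ B (suc j) ⟩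
  applyUpTo B (suc (suc j))            ∎

foldr-zip-applyUpTo : (g : ℕ × ℚ → ℚ → ℚ) (h : ℕ → ℚ → ℚ) →
  (∀ k b acc → g (k , b) acc ≡ h k b + acc) →
  ∀ f u n → foldr g 0ℚ (zip (applyUpTo f n) (applyUpTo u n)) ≡ ∑[ k < n ] h (f k) (u k)
foldr-zip-applyUpTo g h g≡h f u zero    = refl
foldr-zip-applyUpTo g h g≡h f u (suc n) = begin
  g (f 0 , u 0) (foldr g 0ℚ (zip (applyUpTo f′ n) (applyUpTo u′ n)))
    ≡⟨ g≡h (f 0) (u 0) _ ⟩
  h (f 0) (u 0) + foldr g 0ℚ (zip (applyUpTo f′ n) (applyUpTo u′ n))
    ≡⟨ cong (h (f 0) (u 0) +_) (foldr-zip-applyUpTo g h g≡h f′ u′ n) ⟩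
  h (f 0) (u 0) + ∑[ k < n ] h (f′ k) (u′ k)
    ≡⟨ ∑-head (λ k → h (f k) (u k)) n ⟨
  ∑[ k < suc n ] h (f k) (u k) ∎
  where
  f′ = λ k → f (suc k)
  u′ = λ k → u (suc k)

-- The folding function of bernUpTo is a pattern lambda, so it is only given through its equation.
∑-zip-bernUpTo : ∀ j (g : ℕ × ℚ → ℚ → ℚ) →
  (∀ k b acc → g (k , b) acc ≡ Cℚ (2 ℕ.+ j) k * b + acc) →
  foldr g 0ℚ (zip (upTo (suc j)) (bernUpTo j)) ≡ ∑[ k < suc j ] (Cℚ (2 ℕ.+ j) k * B k)
∑-zip-bernUpTo j g g≡ = begin
  foldr g 0ℚ (zip (upTo (suc j)) (bernUpTo j))
    ≡⟨ cong (λ bs → foldr g 0ℚ (zip (upTo (suc j)) bs)) (bernUpTo≡applyUpTo-B j) ⟩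
  foldr g 0ℚ (zip (upTo (suc j)) (applyUpTo B (suc j)))
    ≡⟨ foldr-zip-applyUpTo g (λ k b → Cℚ (2 ℕ.+ j) k * b) g≡ (λ k → k) B (suc j) ⟩
  ∑[ k < suc j ] (Cℚ (2 ℕ.+ j) k * B k) ∎

B-recurrence : ∀ j → B (suc j) ≡ - (((ℤ.+ 1) / (2 ℕ.+ j)) * ∑[ k < suc j ] (Cℚ (2 ℕ.+ j) k * B k))
B-recurrence j = trans (lastOr-∷ʳ 0ℚ (bernUpTo j) _)
  (cong (λ s → - (((ℤ.+ 1) / (2 ℕ.+ j)) * s)) (∑-zip-bernUpTo j _ (λ k b acc → refl)))

Cℚ-n-1≡n : ∀ n → Cℚ n 1 ≡ ℕ→ℚ n
Cℚ-n-1≡n n = cong ℕ→ℚ (nC1≡n n)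

∑-Cℚ-B≡0 : ∀ j → ∑[ k < 2 ℕ.+ j ] (Cℚ (2 ℕ.+ j) k * B k) ≡ 0ℚ
∑-Cℚ-B≡0 j = begin
  S + Cℚ (2 ℕ.+ j) (suc j) * B (suc j) ≡⟨ cong₂ (λ u v → S + u * v) C[2+j][1+j]≡2+j (B-recurrence j) ⟩
  S + n * (- (1/n * S))                ≡⟨ solve 3 (λ S c d → S :+ d :* (:- (c :* S)) := S :- (c :* d) :* S)
                                                  refl S 1/n n ⟩
  S - (1/n * n) * S                    ≡⟨ cong (λ u → S - u * S) (1/n*n≡1 (2 ℕ.+ j)) ⟩
  S - 1ℚ * S                           ≡⟨ solve 1 (λ S → S :- con 1ℚ :* S := con 0ℚ) refl S ⟩
  0ℚ                                   ∎
  where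
  S   = ∑[ k < suc j ] (Cℚ (2 ℕ.+ j) k * B k)
  1/n = (ℤ.+ 1) / (2 ℕ.+ j)
  n   = ℕ→ℚ (2 ℕ.+ j)
  C[2+j][1+j]≡2+j : Cℚ (2 ℕ.+ j) (suc j) ≡ n
  C[2+j][1+j]≡2+j = trans (cong ℕ→ℚ (trans (nCk≡nC[n∸k] (ℕP.n≤1+n (suc j)))
                                            (cong ((2 ℕ.+ j) C_) (ℕP.m+n∸n≡m 1 j))))
                          (Cℚ-n-1≡n (2 ℕ.+ j))

B⁺ : ℕ → ℚ
B⁺ (suc zero) = B 1 + 1ℚ
B⁺ k          = B k

B⁺≡B : ∀ k → 2 ≤ k → B⁺ k ≡ B k
B⁺≡B (suc (suc k)) _         = refl
B⁺≡B (suc zero)    (s≤s ())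

∑-Cℚ-B⁺ : ∀ q → ∑[ t < suc q ] (Cℚ (suc q) t * B⁺ t) ≡ ℕ→ℚ (suc q)
∑-Cℚ-B⁺ zero    = refl
∑-Cℚ-B⁺ (suc j) = begin
  ∑ (2 ℕ.+ j) g
    ≡⟨ trans (∑-head g (suc j)) (cong (g 0 +_) (∑-head (λ k → g (suc k)) j)) ⟩
  g 0 + (g 1 + R)
    ≡⟨ solve 5 (λ a b x y R → a :+ (b :* (x :+ con 1ℚ) :+ R) := (a :+ (b :* x :+ R)) :+ b)
               refl (g 0) (Cℚ (2 ℕ.+ j) 1) (B 1) (B 0) R ⟩
  (f 0 + (f 1 + R)) + Cℚ (2 ℕ.+ j) 1
    ≡⟨ cong (_+ Cℚ (2 ℕ.+ j) 1) (trans (∑-head f (suc j)) (cong (f 0 +_) (∑-head (λ k → f (suc k)) j))) ⟨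
  ∑ (2 ℕ.+ j) f + Cℚ (2 ℕ.+ j) 1
    ≡⟨ cong₂ _+_ (∑-Cℚ-B≡0 j) (Cℚ-n-1≡n (2 ℕ.+ j)) ⟩
  0ℚ + ℕ→ℚ (2 ℕ.+ j)
    ≡⟨ ℚP.+-identityˡ _ ⟩
  ℕ→ℚ (2 ℕ.+ j) ∎
  where
  g = λ t → Cℚ (2 ℕ.+ j) t * B⁺ t
  f = λ t → Cℚ (2 ℕ.+ j) t * B t
  R = ∑[ k < j ] g (suc (suc k))

faulhaberCoeff : ℕ → ℕ → ℚ
faulhaberCoeff p k = Cℚ p k * B⁺ (p ∸ k)

faulhaberPoly : ℕ → ℚ → ℚ
faulhaberPoly p x = ∑[ k < suc p ] (faulhaberCoeff p k * x ^ k)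

faulhaberPoly⁺ : ℕ → ℚ → ℚ
faulhaberPoly⁺ p x = ∑[ k < p ] (faulhaberCoeff p (suc k) * x ^ suc k)

∑-faulhaberCoeff-suc : ∀ q → ∑[ t < q ] faulhaberCoeff q (suc t) ≡ ℕ→ℚ q
∑-faulhaberCoeff-suc zero    = refl
∑-faulhaberCoeff-suc (suc j) = begin
  ∑[ t < suc j ] faulhaberCoeff (suc j) (suc t)
    ≡⟨ ∑-reverse (λ t → faulhaberCoeff (suc j) (suc t)) (suc j) ⟩
  ∑[ t < suc j ] faulhaberCoeff (suc j) (suc (j ∸ t))
    ≡⟨ ∑-cong-< (suc j) reflect ⟩
  ∑[ t < suc j ] (Cℚ (suc j) t * B⁺ t)
    ≡⟨ ∑-Cℚ-B⁺ j ⟩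
  ℕ→ℚ (suc j) ∎
  where
  reflect : ∀ t → t ℕ.< suc j → faulhaberCoeff (suc j) (suc (j ∸ t)) ≡ Cℚ (suc j) t * B⁺ t
  reflect t (s≤s t≤j) = cong₂ _*_
    (cong ℕ→ℚ (trans (cong (suc j C_) (sym (ℕP.+-∸-assoc 1 t≤j)))
                     (sym (nCk≡nC[n∸k] (ℕP.m≤n⇒m≤1+n t≤j)))))
    (cong B⁺ (ℕP.m∸[m∸n]≡n t≤j))

faulhaberCoeff-Cℚ : ∀ l {q t} → t ≤ q →
  faulhaberCoeff (l ℕ.+ q) (l ℕ.+ t) * Cℚ (l ℕ.+ t) l ≡ Cℚ (l ℕ.+ q) l * faulhaberCoeff q t
faulhaberCoeff-Cℚ l {q} {t} t≤q = go (ℕP.m≤n⇒∃[o]m+o≡n t≤q)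
  where
  go : ∃[ u ] t ℕ.+ u ≡ q →
       faulhaberCoeff (l ℕ.+ q) (l ℕ.+ t) * Cℚ (l ℕ.+ t) l ≡ Cℚ (l ℕ.+ q) l * faulhaberCoeff q t
  go (u , refl) = begin
    Cℚ n (l ℕ.+ t) * B⁺ (n ∸ (l ℕ.+ t)) * Cℚ (l ℕ.+ t) l
      ≡⟨ cong (λ m → Cℚ n (l ℕ.+ t) * B⁺ m * Cℚ (l ℕ.+ t) l)
              (trans (ℕP.[m+n]∸[m+o]≡n∸o l (t ℕ.+ u) t) (ℕP.m+n∸m≡n t u)) ⟩
    Cℚ n (l ℕ.+ t) * B⁺ u * Cℚ (l ℕ.+ t) l
      ≡⟨ solve 3 (λ X b Y → X :* b :* Y := (X :* Y) :* b) refl (Cℚ n (l ℕ.+ t)) (B⁺ u) (Cℚ (l ℕ.+ t) l) ⟩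
    (Cℚ n (l ℕ.+ t) * Cℚ (l ℕ.+ t) l) * B⁺ u
      ≡⟨ cong (_* B⁺ u) (ℕ→ℚ-* (n C (l ℕ.+ t)) ((l ℕ.+ t) C l)) ⟨
    ℕ→ℚ ((n C (l ℕ.+ t)) ℕ.* ((l ℕ.+ t) C l)) * B⁺ u
      ≡⟨ cong (λ m → ℕ→ℚ ((m C (l ℕ.+ t)) ℕ.* ((l ℕ.+ t) C l)) * B⁺ u) (ℕP.+-assoc l t u) ⟨
    ℕ→ℚ (((l ℕ.+ t ℕ.+ u) C (l ℕ.+ t)) ℕ.* ((l ℕ.+ t) C l)) * B⁺ u
      ≡⟨ cong (λ m → ℕ→ℚ m * B⁺ u) (C-trinomial l t u) ⟩
    ℕ→ℚ ((n C l) ℕ.* ((t ℕ.+ u) C t)) * B⁺ u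
      ≡⟨ cong (_* B⁺ u) (ℕ→ℚ-* (n C l) ((t ℕ.+ u) C t)) ⟩
    (Cℚ n l * Cℚ (t ℕ.+ u) t) * B⁺ u
      ≡⟨ ℚP.*-assoc (Cℚ n l) (Cℚ (t ℕ.+ u) t) (B⁺ u) ⟩
    Cℚ n l * (Cℚ (t ℕ.+ u) t * B⁺ u)
      ≡⟨ cong (λ m → Cℚ n l * (Cℚ (t ℕ.+ u) t * B⁺ m)) (ℕP.m+n∸m≡n t u) ⟨
    Cℚ n l * faulhaberCoeff (t ℕ.+ u) t ∎
    where n = l ℕ.+ (t ℕ.+ u)

-- Compares the coefficients of xˡ on both sides of faulhaberPoly-suc.
∑-faulhaberCoeff-Cℚ : ∀ p l → l ≤ p →
  ∑[ k < suc p ] (faulhaberCoeff p k * Cℚ k l) ≡ faulhaberCoeff p l + ℕ→ℚ p * Cℚ (p ∸ 1) l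
∑-faulhaberCoeff-Cℚ p l l≤p = go (ℕP.m≤n⇒∃[o]m+o≡n l≤p)
  where
  go : ∃[ q ] l ℕ.+ q ≡ p →
       ∑[ k < suc p ] (faulhaberCoeff p k * Cℚ k l) ≡ faulhaberCoeff p l + ℕ→ℚ p * Cℚ (p ∸ 1) l
  go (q , refl) = begin
    ∑ (suc (l ℕ.+ q)) f
      ≡⟨ cong (λ m → ∑ m f) (ℕP.+-suc l q) ⟨
    ∑ (l ℕ.+ suc q) f
      ≡⟨ ∑-split f l (suc q) ⟩
    ∑ l f + ∑[ t < suc q ] f (l ℕ.+ t)
      ≡⟨ cong₂ _+_ (∑-zero l below)
                   (∑-cong-< (suc q) (λ t t<1+q → faulhaberCoeff-Cℚ l (ℕP.≤-pred t<1+q))) ⟩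
    0ℚ + ∑[ t < suc q ] (X * faulhaberCoeff q t)
      ≡⟨ cong (0ℚ +_) (*-distribˡ-∑ X (faulhaberCoeff q) (suc q)) ⟨
    0ℚ + X * ∑[ t < suc q ] faulhaberCoeff q t
      ≡⟨ cong (λ v → 0ℚ + X * v)
              (trans (∑-head (faulhaberCoeff q) q) (cong (1ℚ * B⁺ q +_) (∑-faulhaberCoeff-suc q))) ⟩
    0ℚ + X * (1ℚ * B⁺ q + ℕ→ℚ q)
      ≡⟨ solve 3 (λ X b q → con 0ℚ :+ X :* (con 1ℚ :* b :+ q) := X :* b :+ X :* q) refl X (B⁺ q) (ℕ→ℚ q) ⟩
    X * B⁺ q + X * ℕ→ℚ q
      ≡⟨ cong₂ (λ u v → X * B⁺ u + v) (ℕP.m+n∸m≡n l q) absorb ⟨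
    faulhaberCoeff (l ℕ.+ q) l + ℕ→ℚ (l ℕ.+ q) * Cℚ (l ℕ.+ q ∸ 1) l ∎
    where
    f = λ k → faulhaberCoeff (l ℕ.+ q) k * Cℚ k l
    X = Cℚ (l ℕ.+ q) l
    below : ∀ k → k ℕ.< l → f k ≡ 0ℚ
    below k k<l = trans (cong (λ c → faulhaberCoeff (l ℕ.+ q) k * ℕ→ℚ c) (k>n⇒nCk≡0 k<l))
                        (ℚP.*-zeroʳ (faulhaberCoeff (l ℕ.+ q) k))
    absorb : ℕ→ℚ (l ℕ.+ q) * Cℚ (l ℕ.+ q ∸ 1) l ≡ X * ℕ→ℚ q
    absorb = begin
      ℕ→ℚ (l ℕ.+ q) * Cℚ (l ℕ.+ q ∸ 1) l       ≡⟨ ℕ→ℚ-* (l ℕ.+ q) ((l ℕ.+ q ∸ 1) C l) ⟨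
      ℕ→ℚ ((l ℕ.+ q) ℕ.* ((l ℕ.+ q ∸ 1) C l))  ≡⟨ cong ℕ→ℚ (C-absorption l q) ⟨
      ℕ→ℚ (((l ℕ.+ q) C l) ℕ.* q)              ≡⟨ ℕ→ℚ-* ((l ℕ.+ q) C l) q ⟩
      X * ℕ→ℚ q                                ∎

faulhaberPoly-suc : ∀ p x → faulhaberPoly p (x + 1ℚ) ≡ faulhaberPoly p x + ℕ→ℚ p * (x + 1ℚ) ^ (p ∸ 1)
faulhaberPoly-suc p x = begin
  ∑[ k < suc p ] (a k * (x + 1ℚ) ^ k)
    ≡⟨ ∑-cong-< (suc p) (λ k k≤p → trans (cong (a k *_) (binomial x k (suc p) k≤p))
                                         (*-distribˡ-∑ (a k) _ (suc p))) ⟩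
  ∑[ k < suc p ] ∑[ l < suc p ] (a k * (Cℚ k l * x ^ l))
    ≡⟨ ∑-comm (λ k l → a k * (Cℚ k l * x ^ l)) (suc p) (suc p) ⟩
  ∑[ l < suc p ] ∑[ k < suc p ] (a k * (Cℚ k l * x ^ l))
    ≡⟨ ∑-cong (suc p) (λ l → trans (∑-cong (suc p) (λ k → sym (ℚP.*-assoc (a k) (Cℚ k l) (x ^ l))))
                                   (sym (*-distribʳ-∑ (x ^ l) (λ k → a k * Cℚ k l) (suc p)))) ⟩
  ∑[ l < suc p ] (∑[ k < suc p ] (a k * Cℚ k l) * x ^ l)
    ≡⟨ ∑-cong-< (suc p) (λ l l<1+p → cong (_* x ^ l) (∑-faulhaberCoeff-Cℚ p l (ℕP.≤-pred l<1+p))) ⟩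
  ∑[ l < suc p ] ((a l + ℕ→ℚ p * Cℚ (p ∸ 1) l) * x ^ l)
    ≡⟨ ∑-cong (suc p) (λ l → solve 4 (λ a P c y → (a :+ P :* c) :* y := a :* y :+ P :* (c :* y))
                                     refl (a l) (ℕ→ℚ p) (Cℚ (p ∸ 1) l) (x ^ l)) ⟩
  ∑[ l < suc p ] (a l * x ^ l + ℕ→ℚ p * (Cℚ (p ∸ 1) l * x ^ l))
    ≡⟨ ∑-distrib-+ _ _ (suc p) ⟩
  faulhaberPoly p x + ∑[ l < suc p ] (ℕ→ℚ p * (Cℚ (p ∸ 1) l * x ^ l))
    ≡⟨ cong (faulhaberPoly p x +_) (*-distribˡ-∑ (ℕ→ℚ p) _ (suc p)) ⟨
  faulhaberPoly p x + ℕ→ℚ p * ∑[ l < suc p ] (Cℚ (p ∸ 1) l * x ^ l)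
    ≡⟨ cong (λ v → faulhaberPoly p x + ℕ→ℚ p * v) (binomial x (p ∸ 1) (suc p) (s≤s (ℕP.m∸n≤m p 1))) ⟨
  faulhaberPoly p x + ℕ→ℚ p * (x + 1ℚ) ^ (p ∸ 1) ∎
  where a = faulhaberCoeff p

faulhaberPoly⁺-suc : ∀ p x → faulhaberPoly⁺ p (x + 1ℚ) ≡ faulhaberPoly⁺ p x + ℕ→ℚ p * (x + 1ℚ) ^ (p ∸ 1)
faulhaberPoly⁺-suc p x = +-cancelˡ c _ _ (begin
  c + faulhaberPoly⁺ p (x + 1ℚ)   ≡⟨ ∑-head (λ k → faulhaberCoeff p k * (x + 1ℚ) ^ k) p ⟨
  faulhaberPoly p (x + 1ℚ)        ≡⟨ faulhaberPoly-suc p x ⟩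
  faulhaberPoly p x + d           ≡⟨ cong (_+ d) (∑-head (λ k → faulhaberCoeff p k * x ^ k) p) ⟩
  (c + faulhaberPoly⁺ p x) + d    ≡⟨ ℚP.+-assoc c (faulhaberPoly⁺ p x) d ⟩
  c + (faulhaberPoly⁺ p x + d)    ∎)
  where
  c = faulhaberCoeff p 0 * 1ℚ
  d = ℕ→ℚ p * (x + 1ℚ) ^ (p ∸ 1)

faulhaber : ∀ p n → faulhaberPoly⁺ p (ℕ→ℚ n) ≡ ℕ→ℚ p * ℕ→ℚ (hyperSum (p ∸ 1) 1 n)
faulhaber p zero    = trans (∑-zero p vanish) (sym (ℚP.*-zeroʳ (ℕ→ℚ p)))
  where
  vanish : ∀ k → k ℕ.< p → faulhaberCoeff p (suc k) * 0ℚ ^ suc k ≡ 0ℚ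
  vanish k _ = trans (cong (faulhaberCoeff p (suc k) *_) (ℚP.*-zeroˡ (0ℚ ^ k))) (ℚP.*-zeroʳ (faulhaberCoeff p (suc k)))
faulhaber p (suc n) = begin
  faulhaberPoly⁺ p (ℕ→ℚ (suc n))
    ≡⟨ cong (faulhaberPoly⁺ p) (ℕ→ℚ-suc n) ⟩
  faulhaberPoly⁺ p (ℕ→ℚ n + 1ℚ)
    ≡⟨ faulhaberPoly⁺-suc p (ℕ→ℚ n) ⟩
  faulhaberPoly⁺ p (ℕ→ℚ n) + ℕ→ℚ p * (ℕ→ℚ n + 1ℚ) ^ (p ∸ 1)
    ≡⟨ cong₂ (λ u v → u + ℕ→ℚ p * v) (faulhaber p n) power ⟩
  ℕ→ℚ p * ℕ→ℚ (hyperSum (p ∸ 1) 1 n) + ℕ→ℚ p * ℕ→ℚ (suc n ℕ.^ (p ∸ 1))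
    ≡⟨ ℚP.*-distribˡ-+ (ℕ→ℚ p) _ _ ⟨
  ℕ→ℚ p * (ℕ→ℚ (hyperSum (p ∸ 1) 1 n) + ℕ→ℚ (suc n ℕ.^ (p ∸ 1)))
    ≡⟨ cong (ℕ→ℚ p *_) (ℕ→ℚ-+ (hyperSum (p ∸ 1) 1 n) _) ⟨
  ℕ→ℚ p * ℕ→ℚ (hyperSum (p ∸ 1) 1 (suc n)) ∎
  where
  power : (ℕ→ℚ n + 1ℚ) ^ (p ∸ 1) ≡ ℕ→ℚ (suc n ℕ.^ (p ∸ 1))
  power = trans (cong (_^ (p ∸ 1)) (sym (ℕ→ℚ-suc n))) (sym (ℕ→ℚ-^ (suc n) (p ∸ 1)))

-- Hyper-sums

Sℚ : ℕ → ℕ → ℕ → ℚ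
Sℚ m r n = ℕ→ℚ (hyperSum m r n)

Sℚ-suc : ∀ m r n → Sℚ m (suc r) (suc n) ≡ Sℚ m (suc r) n + Sℚ m r (suc n)
Sℚ-suc m r n = ℕ→ℚ-+ (hyperSum m (suc r) n) (hyperSum m r (suc n))

hyperFaulhaber : ∀ p r n →
  ∑[ k < p ] (faulhaberCoeff p (suc k) * Sℚ (suc k) r n) ≡ ℕ→ℚ p * Sℚ (p ∸ 1) (suc r) n
hyperFaulhaber p zero    n       =
  trans (∑-cong p (λ k → cong (faulhaberCoeff p (suc k) *_) (ℕ→ℚ-^ n (suc k)))) (faulhaber p n)
hyperFaulhaber p (suc r) zero    =
  trans (∑-zero p (λ k _ → ℚP.*-zeroʳ (faulhaberCoeff p (suc k)))) (sym (ℚP.*-zeroʳ (ℕ→ℚ p)))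
hyperFaulhaber p (suc r) (suc n) = begin
  ∑[ k < p ] (a k * Sℚ (suc k) (suc r) (suc n))
    ≡⟨ ∑-cong p (λ k → trans (cong (a k *_) (Sℚ-suc (suc k) r n)) (ℚP.*-distribˡ-+ (a k) _ _)) ⟩
  ∑[ k < p ] (a k * Sℚ (suc k) (suc r) n + a k * Sℚ (suc k) r (suc n))
    ≡⟨ ∑-distrib-+ _ _ p ⟩
  ∑[ k < p ] (a k * Sℚ (suc k) (suc r) n) + ∑[ k < p ] (a k * Sℚ (suc k) r (suc n))
    ≡⟨ cong₂ _+_ (hyperFaulhaber p (suc r) n) (hyperFaulhaber p r (suc n)) ⟩
  ℕ→ℚ p * Sℚ (p ∸ 1) (2 ℕ.+ r) n + ℕ→ℚ p * Sℚ (p ∸ 1) (suc r) (suc n)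
    ≡⟨ ℚP.*-distribˡ-+ (ℕ→ℚ p) _ _ ⟨
  ℕ→ℚ p * (Sℚ (p ∸ 1) (2 ℕ.+ r) n + Sℚ (p ∸ 1) (suc r) (suc n))
    ≡⟨ cong (ℕ→ℚ p *_) (Sℚ-suc (p ∸ 1) (suc r) n) ⟨
  ℕ→ℚ p * Sℚ (p ∸ 1) (2 ℕ.+ r) (suc n) ∎
  where a = λ k → faulhaberCoeff p (suc k)

-- The part of row w + 1 of H below the diagonal, without its factor r, applied to (S₁, S₂, …).
lowerSum : ℕ → ℕ → ℕ → ℚ
lowerSum w r n = ∑[ b < w ] (Cℚ (2 ℕ.+ w) (suc b) * B (suc w ∸ b) * Sℚ (suc b) r n)

lowerSum-suc : ∀ w r n → lowerSum w (suc r) (suc n) ≡ lowerSum w (suc r) n + lowerSum w r (suc n)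
lowerSum-suc w r n =
  trans (∑-cong w (λ b → trans (cong (c b *_) (Sℚ-suc (suc b) r n)) (ℚP.*-distribˡ-+ (c b) _ _)))
        (∑-distrib-+ _ _ w)
  where c = λ b → Cℚ (2 ℕ.+ w) (suc b) * B (suc w ∸ b)

-- hyperFaulhaber for p = w + 2, with its last two terms written out.
hyperFaulhaber-row : ∀ w r n →
  lowerSum w r n + ℕ→ℚ (2 ℕ.+ w) * ½ * Sℚ (suc w) r n + Sℚ (2 ℕ.+ w) r n
    ≡ ℕ→ℚ (2 ℕ.+ w) * Sℚ (suc w) (suc r) n
hyperFaulhaber-row w r n =
  trans (sym (cong₂ _+_ (cong₂ _+_ lower diagonal) top)) (hyperFaulhaber (2 ℕ.+ w) r n)
  where
  f = λ k → faulhaberCoeff (2 ℕ.+ w) (suc k) * Sℚ (suc k) r n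
  lower : ∑ w f ≡ lowerSum w r n
  lower = ∑-cong-< w (λ b b<w → cong (λ x → Cℚ (2 ℕ.+ w) (suc b) * x * Sℚ (suc b) r n)
                                     (B⁺≡B (suc w ∸ b) (ℕP.m+n≤o⇒m≤o∸n 2 (s≤s b<w))))
  C[2+w][1+w]≡2+w : (2 ℕ.+ w) C (suc w) ≡ 2 ℕ.+ w
  C[2+w][1+w]≡2+w = trans (nCk≡nC[n∸k] (ℕP.n≤1+n (suc w)))
                          (trans (cong ((2 ℕ.+ w) C_) (ℕP.m+n∸n≡m 1 (suc w))) (nC1≡n (2 ℕ.+ w)))
  diagonal : f w ≡ ℕ→ℚ (2 ℕ.+ w) * ½ * Sℚ (suc w) r n
  diagonal = cong₂ (λ c m → ℕ→ℚ c * B⁺ m * Sℚ (suc w) r n) C[2+w][1+w]≡2+w (ℕP.m+n∸n≡m 1 w)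
  top : f (suc w) ≡ Sℚ (2 ℕ.+ w) r n
  top = trans (cong₂ (λ c m → ℕ→ℚ c * B⁺ m * Sℚ (2 ℕ.+ w) r n) (nCn≡1 (2 ℕ.+ w)) (ℕP.n∸n≡0 (suc w)))
              (ℚP.*-identityˡ (Sℚ (2 ℕ.+ w) r n))

-- For R = r, W = w + 2, ν = n and E = lowerSum w r n this is row w + 1 of H applied to (S₁, S₂, …).
rowForm : (R W ν E Y X : ℚ) → ℚ
rowForm R W ν E Y X = R * E - W * (ν + R * ½) * Y + (R + W) * X

rowForm-step : ∀ r n W E₁ E₂ Y₁ Y₂ X₁ X₂ →
  rowForm (ℕ→ℚ (suc r)) W (ℕ→ℚ n) E₁ Y₁ X₁ ≡ 0ℚ →
  rowForm (ℕ→ℚ r) W (ℕ→ℚ (suc n)) E₂ Y₂ X₂ ≡ 0ℚ →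
  E₂ + W * ½ * Y₂ + X₂ ≡ W * (Y₁ + Y₂) →
  rowForm (ℕ→ℚ (suc r)) W (ℕ→ℚ (suc n)) (E₁ + E₂) (Y₁ + Y₂) (X₁ + X₂) ≡ 0ℚ
rowForm-step r n W E₁ E₂ Y₁ Y₂ X₁ X₂ row₁ row₂ faulhaberRow rewrite ℕ→ℚ-suc r | ℕ→ℚ-suc n = begin
  rowForm (R + 1ℚ) W (ν + 1ℚ) (E₁ + E₂) (Y₁ + Y₂) (X₁ + X₂)
    ≡⟨ solve 9 (λ R W ν E₁ E₂ Y₁ Y₂ X₁ X₂ →
         (R :+ con 1ℚ) :* (E₁ :+ E₂) :- W :* ((ν :+ con 1ℚ) :+ (R :+ con 1ℚ) :* con ½) :* (Y₁ :+ Y₂)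
           :+ ((R :+ con 1ℚ) :+ W) :* (X₁ :+ X₂)
         := ((R :+ con 1ℚ) :* E₁ :- W :* (ν :+ (R :+ con 1ℚ) :* con ½) :* Y₁ :+ ((R :+ con 1ℚ) :+ W) :* X₁)
            :+ (R :* E₂ :- W :* ((ν :+ con 1ℚ) :+ R :* con ½) :* Y₂ :+ (R :+ W) :* X₂)
            :+ ((E₂ :+ W :* con ½ :* Y₂ :+ X₂) :- W :* (Y₁ :+ Y₂)))
       refl R W ν E₁ E₂ Y₁ Y₂ X₁ X₂ ⟩
  rowForm (R + 1ℚ) W ν E₁ Y₁ X₁ + rowForm R W (ν + 1ℚ) E₂ Y₂ X₂
    + ((E₂ + W * ½ * Y₂ + X₂) - W * (Y₁ + Y₂))
    ≡⟨ cong₂ _+_ (cong₂ _+_ row₁ row₂) (x≈y⇒x∙y⁻¹≈ε faulhaberRow) ⟩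
  0ℚ ∎
  where
  R = ℕ→ℚ r
  ν = ℕ→ℚ n

rowIdentity : ∀ r w n →
  rowForm (ℕ→ℚ r) (ℕ→ℚ (2 ℕ.+ w)) (ℕ→ℚ n) (lowerSum w r n) (Sℚ (suc w) r n) (Sℚ (2 ℕ.+ w) r n) ≡ 0ℚ
rowIdentity zero    w n       = begin
  rowForm 0ℚ W ν (lowerSum w 0 n) Y (ℕ→ℚ (n ℕ.* n ℕ.^ suc w))
    ≡⟨ cong (rowForm 0ℚ W ν (lowerSum w 0 n) Y) (ℕ→ℚ-* n (n ℕ.^ suc w)) ⟩
  rowForm 0ℚ W ν (lowerSum w 0 n) Y (ν * Y)
    ≡⟨ solve 4 (λ W ν E Y → con 0ℚ :* E :- W :* (ν :+ con 0ℚ :* con ½) :* Y :+ (con 0ℚ :+ W) :* (ν :* Y)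
                            := con 0ℚ) refl W ν (lowerSum w 0 n) Y ⟩
  0ℚ ∎
  where
  W = ℕ→ℚ (2 ℕ.+ w)
  ν = ℕ→ℚ n
  Y = Sℚ (suc w) 0 n
rowIdentity (suc r) w zero    = begin
  rowForm R W 0ℚ (lowerSum w (suc r) 0) 0ℚ 0ℚ
    ≡⟨ cong (λ E → rowForm R W 0ℚ E 0ℚ 0ℚ)
            (∑-zero w (λ b _ → ℚP.*-zeroʳ (Cℚ (2 ℕ.+ w) (suc b) * B (suc w ∸ b)))) ⟩
  rowForm R W 0ℚ 0ℚ 0ℚ 0ℚ
    ≡⟨ solve 2 (λ R W → R :* con 0ℚ :- W :* (con 0ℚ :+ R :* con ½) :* con 0ℚ :+ (R :+ W) :* con 0ℚ := con 0ℚ)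
               refl R W ⟩
  0ℚ ∎
  where
  R = ℕ→ℚ (suc r)
  W = ℕ→ℚ (2 ℕ.+ w)
rowIdentity (suc r) w (suc n) = begin
  rowForm R W ν (lowerSum w (suc r) (suc n)) (Sℚ (suc w) (suc r) (suc n)) (Sℚ (2 ℕ.+ w) (suc r) (suc n))
    ≡⟨ cong₂ (λ E Y → rowForm R W ν E Y (Sℚ (2 ℕ.+ w) (suc r) (suc n))) (lowerSum-suc w r n) (Sℚ-suc (suc w) r n) ⟩
  rowForm R W ν (E₁ + E₂) (Y₁ + Y₂) (Sℚ (2 ℕ.+ w) (suc r) (suc n))
    ≡⟨ cong (rowForm R W ν (E₁ + E₂) (Y₁ + Y₂)) (Sℚ-suc (2 ℕ.+ w) r n) ⟩
  rowForm R W ν (E₁ + E₂) (Y₁ + Y₂) (X₁ + X₂)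
    ≡⟨ rowForm-step r n W E₁ E₂ Y₁ Y₂ X₁ X₂ (rowIdentity (suc r) w n) (rowIdentity r w (suc n)) faulhaberRow ⟩
  0ℚ ∎
  where
  R  = ℕ→ℚ (suc r)
  W  = ℕ→ℚ (2 ℕ.+ w)
  ν  = ℕ→ℚ (suc n)
  E₁ = lowerSum w (suc r) n
  E₂ = lowerSum w r (suc n)
  Y₁ = Sℚ (suc w) (suc r) n
  Y₂ = Sℚ (suc w) r (suc n)
  X₁ = Sℚ (2 ℕ.+ w) (suc r) n
  X₂ = Sℚ (2 ℕ.+ w) r (suc n)
  faulhaberRow : E₂ + W * ½ * Y₂ + X₂ ≡ W * (Y₁ + Y₂)
  faulhaberRow = trans (hyperFaulhaber-row w r (suc n)) (cong (W *_) (Sℚ-suc (suc w) r n))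

-- Determinants of lower Hessenberg matrices

sumFin-cong : ∀ n {f g : Fin n → ℚ} → (∀ j → f j ≡ g j) → sumFin n f ≡ sumFin n g
sumFin-cong zero    f≡g = refl
sumFin-cong (suc n) f≡g = cong₂ _+_ (f≡g Fin.zero) (sumFin-cong n (λ j → f≡g (Fin.suc j)))

sumFin-zero : ∀ n {f : Fin n → ℚ} → (∀ j → f j ≡ 0ℚ) → sumFin n f ≡ 0ℚ
sumFin-zero zero    f≡0 = refl
sumFin-zero (suc n) f≡0 = cong₂ _+_ (f≡0 Fin.zero) (sumFin-zero n (λ j → f≡0 (Fin.suc j)))

sumFin-linear : ∀ n α β (f g : Fin n → ℚ) →
  sumFin n (λ j → α * f j + β * g j) ≡ α * sumFin n f + β * sumFin n g
sumFin-linear zero    α β f g = solve 2 (λ α β → con 0ℚ := α :* con 0ℚ :+ β :* con 0ℚ) refl α β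
sumFin-linear (suc n) α β f g rewrite sumFin-linear n α β (λ j → f (Fin.suc j)) (λ j → g (Fin.suc j)) =
  solve 6 (λ α β a b A B → (α :* a :+ β :* b) :+ (α :* A :+ β :* B) := α :* (a :+ A) :+ β :* (b :+ B)) refl
    α β (f Fin.zero) (g Fin.zero) (sumFin n (λ j → f (Fin.suc j))) (sumFin n (λ j → g (Fin.suc j)))

Matrix : ℕ → Set
Matrix n = Fin n → Fin n → ℚ

toMatrix : (s : ℕ) → (ℕ → ℕ → ℚ) → Matrix s
toMatrix s F i j = F (toℕ i) (toℕ j)

minor : ∀ {n} → Matrix (suc n) → Fin (suc n) → Matrix n
minor M j a b = M (Fin.suc a) (punchIn j b)

cofactorTerm : ∀ {n} → Matrix (suc n) → Fin (suc n) → ℚ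
cofactorTerm {n} M j = negOnePow (toℕ j) * M Fin.zero j * det n (minor M j)

det-cong : ∀ n {M M′ : Matrix n} → (∀ i j → M i j ≡ M′ i j) → det n M ≡ det n M′
det-cong zero    M≡M′ = refl
det-cong (suc n) M≡M′ = sumFin-cong (suc n) (λ j →
  cong₂ (λ x d → negOnePow (toℕ j) * x * d)
        (M≡M′ Fin.zero j) (det-cong n (λ a b → M≡M′ (Fin.suc a) (punchIn j b))))

det-linear-column₀ : ∀ n (M₁ M₂ M : Matrix (suc n)) α β →
  (∀ i j → M₁ i (Fin.suc j) ≡ M i (Fin.suc j)) → (∀ i j → M₂ i (Fin.suc j) ≡ M i (Fin.suc j)) →
  (∀ i → M i Fin.zero ≡ α * M₁ i Fin.zero + β * M₂ i Fin.zero) →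
  det (suc n) M ≡ α * det (suc n) M₁ + β * det (suc n) M₂

cofactorTerm-linear-column₀ : ∀ n (M₁ M₂ M : Matrix (suc n)) α β →
  (∀ i j → M₁ i (Fin.suc j) ≡ M i (Fin.suc j)) → (∀ i j → M₂ i (Fin.suc j) ≡ M i (Fin.suc j)) →
  (∀ i → M i Fin.zero ≡ α * M₁ i Fin.zero + β * M₂ i Fin.zero) →
  ∀ j → cofactorTerm M j ≡ α * cofactorTerm M₁ j + β * cofactorTerm M₂ j
cofactorTerm-linear-column₀ n M₁ M₂ M α β agree₁ agree₂ column₀ Fin.zero = begin
  1ℚ * M Fin.zero Fin.zero * D
    ≡⟨ cong (λ x → 1ℚ * x * D) (column₀ Fin.zero) ⟩
  1ℚ * (α * x₁ + β * x₂) * D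
    ≡⟨ solve 5 (λ α β x y D → con 1ℚ :* (α :* x :+ β :* y) :* D
                              := α :* (con 1ℚ :* x :* D) :+ β :* (con 1ℚ :* y :* D)) refl α β x₁ x₂ D ⟩
  α * (1ℚ * x₁ * D) + β * (1ℚ * x₂ * D)
    ≡⟨ cong₂ (λ D₁ D₂ → α * (1ℚ * x₁ * D₁) + β * (1ℚ * x₂ * D₂))
             (det-cong n (λ a b → sym (agree₁ (Fin.suc a) b))) (det-cong n (λ a b → sym (agree₂ (Fin.suc a) b))) ⟩
  α * cofactorTerm M₁ Fin.zero + β * cofactorTerm M₂ Fin.zero ∎
  where
  D  = det n (minor M Fin.zero)
  x₁ = M₁ Fin.zero Fin.zero
  x₂ = M₂ Fin.zero Fin.zero
cofactorTerm-linear-column₀ (suc n) M₁ M₂ M α β agree₁ agree₂ column₀ (Fin.suc j) = begin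
  σ * x * det (suc n) (minor M (Fin.suc j))
    ≡⟨ cong (σ * x *_) (det-linear-column₀ n (minor M₁ (Fin.suc j)) (minor M₂ (Fin.suc j)) (minor M (Fin.suc j)) α β
                         (λ a b → agree₁ (Fin.suc a) (punchIn j b)) (λ a b → agree₂ (Fin.suc a) (punchIn j b))
                         (λ a → column₀ (Fin.suc a))) ⟩
  σ * x * (α * D₁ + β * D₂)
    ≡⟨ solve 6 (λ σ x α β D₁ D₂ → σ :* x :* (α :* D₁ :+ β :* D₂)
                                   := α :* (σ :* x :* D₁) :+ β :* (σ :* x :* D₂)) refl σ x α β D₁ D₂ ⟩
  α * (σ * x * D₁) + β * (σ * x * D₂)
    ≡⟨ cong₂ (λ x₁ x₂ → α * (σ * x₁ * D₁) + β * (σ * x₂ * D₂))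
             (sym (agree₁ Fin.zero j)) (sym (agree₂ Fin.zero j)) ⟩
  α * cofactorTerm M₁ (Fin.suc j) + β * cofactorTerm M₂ (Fin.suc j) ∎
  where
  σ  = negOnePow (toℕ (Fin.suc j))
  x  = M Fin.zero (Fin.suc j)
  D₁ = det (suc n) (minor M₁ (Fin.suc j))
  D₂ = det (suc n) (minor M₂ (Fin.suc j))

det-linear-column₀ n M₁ M₂ M α β agree₁ agree₂ column₀ =
  trans (sumFin-cong (suc n) (cofactorTerm-linear-column₀ n M₁ M₂ M α β agree₁ agree₂ column₀))
        (sumFin-linear (suc n) α β (cofactorTerm M₁) (cofactorTerm M₂))

minor₀₀ minor₀₁ : ∀ s → (ℕ → ℕ → ℚ) → Matrix (suc s)
minor₀₀ s F = minor (toMatrix (2 ℕ.+ s) F) Fin.zero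
minor₀₁ s F = minor (toMatrix (2 ℕ.+ s) F) (Fin.suc Fin.zero)

det-expand-firstRow₂ : ∀ s (F : ℕ → ℕ → ℚ) → (∀ b → F 0 (2 ℕ.+ b) ≡ 0ℚ) →
  det (2 ℕ.+ s) (toMatrix (2 ℕ.+ s) F) ≡ F 0 0 * det (suc s) (minor₀₀ s F) - F 0 1 * det (suc s) (minor₀₁ s F)
det-expand-firstRow₂ s F vanish = begin
  1ℚ * F 0 0 * dA + ((- 1ℚ) * F 0 1 * dB + rest)
    ≡⟨ cong (λ x → 1ℚ * F 0 0 * dA + ((- 1ℚ) * F 0 1 * dB + x)) rest≡0 ⟩
  1ℚ * F 0 0 * dA + ((- 1ℚ) * F 0 1 * dB + 0ℚ)
    ≡⟨ solve 4 (λ a A b B → con 1ℚ :* a :* A :+ ((:- con 1ℚ) :* b :* B :+ con 0ℚ) := a :* A :- b :* B)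
               refl (F 0 0) dA (F 0 1) dB ⟩
  F 0 0 * dA - F 0 1 * dB ∎
  where
  M    = toMatrix (2 ℕ.+ s) F
  dA   = det (suc s) (minor₀₀ s F)
  dB   = det (suc s) (minor₀₁ s F)
  rest = sumFin s (λ j → cofactorTerm M (Fin.suc (Fin.suc j)))
  σ    = λ j → negOnePow (toℕ (Fin.suc (Fin.suc j)))
  D    = λ j → det (suc s) (minor M (Fin.suc (Fin.suc j)))
  rest≡0 : rest ≡ 0ℚ
  rest≡0 = sumFin-zero s (λ j → trans (cong (λ x → σ j * x * D j) (vanish (toℕ j)))
                                      (solve 2 (λ σ D → σ :* con 0ℚ :* D := con 0ℚ) refl (σ j) (D j)))

mergeColumns : (ℕ → ℕ → ℚ) → ℚ → ℚ → ℕ → ℕ → ℚ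
mergeColumns F z₀ z₁ a zero    = z₀ * F (suc a) 0 + z₁ * F (suc a) 1
mergeColumns F z₀ z₁ a (suc b) = F (suc a) (2 ℕ.+ b)

det-mergeColumns : ∀ s F z₀ z₁ →
  det (suc s) (toMatrix (suc s) (mergeColumns F z₀ z₁))
    ≡ z₀ * det (suc s) (minor₀₁ s F) + z₁ * det (suc s) (minor₀₀ s F)
det-mergeColumns s F z₀ z₁ =
  det-linear-column₀ s (minor₀₁ s F) (minor₀₀ s F) (toMatrix (suc s) (mergeColumns F z₀ z₁)) z₀ z₁
                     (λ _ _ → refl) (λ _ _ → refl) (λ _ → refl)

rowValue : (ℕ → ℕ → ℚ) → (ℕ → ℚ) → (ℕ → ℚ) → ℕ → ℚ
rowValue F c z a = ∑[ b < suc a ] (F a b * z b) + c a * z (suc a)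

dropSolution : (ℕ → ℚ) → ℕ → ℚ
dropSolution z zero    = 1ℚ
dropSolution z (suc b) = z (2 ℕ.+ b)

rowValue-mergeColumns : ∀ F c z a →
  rowValue (mergeColumns F (z 0) (z 1)) (λ a → c (suc a)) (dropSolution z) a ≡ rowValue F c z (suc a)
rowValue-mergeColumns F c z a = cong (_+ c (suc a) * z (2 ℕ.+ a)) (begin
  ∑[ b < suc a ] (mergeColumns F (z 0) (z 1) a b * dropSolution z b)
    ≡⟨ ∑-head (λ b → mergeColumns F (z 0) (z 1) a b * dropSolution z b) a ⟩
  (z 0 * F (suc a) 0 + z 1 * F (suc a) 1) * 1ℚ + R
    ≡⟨ solve 5 (λ z₀ f₀ z₁ f₁ R → (z₀ :* f₀ :+ z₁ :* f₁) :* con 1ℚ :+ R := f₀ :* z₀ :+ (f₁ :* z₁ :+ R))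
               refl (z 0) (F (suc a) 0) (z 1) (F (suc a) 1) R ⟩
  F (suc a) 0 * z 0 + (F (suc a) 1 * z 1 + R)
    ≡⟨ trans (∑-head _ (suc a)) (cong (F (suc a) 0 * z 0 +_) (∑-head _ a)) ⟨
  ∑[ b < 2 ℕ.+ a ] (F (suc a) b * z b) ∎)
  where R = ∑[ b < a ] (F (suc a) (2 ℕ.+ b) * z (2 ℕ.+ b))

-- Cramer's rule for the last unknown of a lower Hessenberg system. By induction on s: expand
-- along the first row, and use row 0 to eliminate z₀ in favour of the merged matrix.
det-hessenberg : ∀ s (F : ℕ → ℕ → ℚ) (c z : ℕ → ℚ) →
  (∀ a b → suc a ℕ.< b → F a b ≡ 0ℚ) →
  (∀ a → F a (suc a) ≡ c a) →
  (∀ a → rowValue F c z a ≡ 0ℚ) →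
  det s (toMatrix s F) * z 0 ≡ negOnePow s * ∏ s c * z s
det-hessenberg zero          F c z hess super rows =
  solve 1 (λ z → con 1ℚ :* z := con 1ℚ :* con 1ℚ :* z) refl (z 0)
det-hessenberg (suc zero)    F c z hess super rows = x∙y⁻¹≈ε⇒x≈y _ _ (trans
  (solve 4 (λ f z₀ c z₁ → (con 1ℚ :* f :* con 1ℚ :+ con 0ℚ) :* z₀ :- (:- con 1ℚ) :* (c :* con 1ℚ) :* z₁
                          := (con 0ℚ :+ f :* z₀) :+ c :* z₁) refl (F 0 0) (z 0) (c 0) (z 1))
  (rows 0))
det-hessenberg (suc (suc s)) F c z hess super rows = x∙y⁻¹≈ε⇒x≈y _ _ (begin
  det (2 ℕ.+ s) (toMatrix (2 ℕ.+ s) F) * z 0 - (- σ) * (c 0 * Π) * z (2 ℕ.+ s)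
    ≡⟨ cong (λ d → d * z 0 - (- σ) * (c 0 * Π) * z (2 ℕ.+ s)) expand ⟩
  (F 0 0 * dA - c 0 * dB) * z 0 - (- σ) * (c 0 * Π) * z (2 ℕ.+ s)
    ≡⟨ solve 10 (λ f dA c dB z₀ σ Π z z₁ dM →
         (f :* dA :- c :* dB) :* z₀ :- (:- σ) :* (c :* Π) :* z
         := dA :* ((con 0ℚ :+ f :* z₀) :+ c :* z₁) :+ c :* (dM :- (z₀ :* dB :+ z₁ :* dA))
            :- c :* (dM :* con 1ℚ :- σ :* Π :* z))
       refl (F 0 0) dA (c 0) dB (z 0) σ Π (z (2 ℕ.+ s)) (z 1) dM ⟩
  dA * rowValue F c z 0 + c 0 * (dM - (z 0 * dB + z 1 * dA)) - c 0 * (dM * 1ℚ - σ * Π * z (2 ℕ.+ s))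
    ≡⟨ cong₂ (λ x y → dA * x + c 0 * y - c 0 * (dM * 1ℚ - σ * Π * z (2 ℕ.+ s)))
             (rows 0) (x≈y⇒x∙y⁻¹≈ε (det-mergeColumns s F (z 0) (z 1))) ⟩
  dA * 0ℚ + c 0 * 0ℚ - c 0 * (dM * 1ℚ - σ * Π * z (2 ℕ.+ s))
    ≡⟨ cong (λ x → dA * 0ℚ + c 0 * 0ℚ - c 0 * x) (x≈y⇒x∙y⁻¹≈ε
         (det-hessenberg (suc s) F′ (λ a → c (suc a)) (dropSolution z) hess′ (λ a → super (suc a)) rows′)) ⟩
  dA * 0ℚ + c 0 * 0ℚ - c 0 * 0ℚ
    ≡⟨ solve 2 (λ a b → a :* con 0ℚ :+ b :* con 0ℚ :- b :* con 0ℚ := con 0ℚ) refl dA (c 0) ⟩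
  0ℚ ∎)
  where
  σ  = negOnePow (suc s)
  Π  = ∏ (suc s) (λ a → c (suc a))
  F′ = mergeColumns F (z 0) (z 1)
  dA = det (suc s) (minor₀₀ s F)
  dB = det (suc s) (minor₀₁ s F)
  dM = det (suc s) (toMatrix (suc s) F′)
  expand : det (2 ℕ.+ s) (toMatrix (2 ℕ.+ s) F) ≡ F 0 0 * dA - c 0 * dB
  expand = trans (det-expand-firstRow₂ s F (λ b → hess 0 (2 ℕ.+ b) (s≤s (s≤s z≤n))))
                 (cong (λ x → F 0 0 * dA - x * dB) (super 0))
  hess′ : ∀ a b → suc a ℕ.< b → F′ a b ≡ 0ℚ
  hess′ a (suc b) (s≤s a<b) = hess (suc a) (2 ℕ.+ b) (s≤s (s≤s a<b))
  rows′ : ∀ a → rowValue F′ (λ a → c (suc a)) (dropSolution z) a ≡ 0ℚ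
  rows′ a = trans (rowValue-mergeColumns F c z a) (rows (suc a))

-- The matrix H

compare-less : ∀ m k → compare m (suc (m ℕ.+ k)) ≡ less m k
compare-less zero    k = refl
compare-less (suc m) k rewrite compare-less m k = refl

compare-equal : ∀ m → compare m m ≡ equal m
compare-equal zero    = refl
compare-equal (suc m) rewrite compare-equal m = refl

compare-greater : ∀ m k → compare (suc (m ℕ.+ k)) m ≡ greater m k
compare-greater zero    k = refl
compare-greater (suc m) k rewrite compare-greater m k = refl

hEntry-super : ∀ r N i → hEntry r N i (suc i) ≡ ℕ→ℚ (r ℕ.+ i ℕ.+ 1)
hEntry-super r N i = trans (cong (λ m → hEntry r N i (suc m)) (sym (ℕP.+-identityʳ i))) super
  where
  super : hEntry r N i (suc (i ℕ.+ 0)) ≡ ℕ→ℚ (r ℕ.+ i ℕ.+ 1)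
  super rewrite compare-less i 0 = refl

hEntry-above : ∀ r N {i k} → suc i ℕ.< k → hEntry r N i k ≡ 0ℚ
hEntry-above r N {i} {k} i+1<k = go (ℕP.m≤n⇒∃[o]m+o≡n i+1<k)
  where
  go : ∃[ j ] 2 ℕ.+ i ℕ.+ j ≡ k → hEntry r N i k ≡ 0ℚ
  go (j , refl) = trans (cong (λ m → hEntry r N i (suc m)) (sym (ℕP.+-suc i j))) above
    where
    above : hEntry r N i (suc (i ℕ.+ suc j)) ≡ 0ℚ
    above rewrite compare-less i (suc j) = refl

hEntry-diagonal : ∀ r N i → hEntry r N i i ≡ - (ℕ→ℚ (suc i) * N)
hEntry-diagonal r N i rewrite compare-equal i = cong (λ m → - (ℕ→ℚ m * N)) (ℕP.+-comm i 1)

hEntry-below : ∀ r N {i k} → k ℕ.< i → hEntry r N i k ≡ ℕ→ℚ r * Cℚ (suc i) k * B (suc i ∸ k)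
hEntry-below r N {i} {k} k<i = go (ℕP.m≤n⇒∃[o]m+o≡n k<i)
  where
  go : ∃[ j ] suc k ℕ.+ j ≡ i → hEntry r N i k ≡ ℕ→ℚ r * Cℚ (suc i) k * B (suc i ∸ k)
  go (j , refl) rewrite compare-greater k j =
    trans (cong (λ m → ℕ→ℚ (r ℕ.* (m C k)) * B (m ∸ k)) (ℕP.+-comm (suc (k ℕ.+ j)) 1))
          (cong (_* B (suc (suc (k ℕ.+ j)) ∸ k)) (ℕ→ℚ-* r ((suc (suc (k ℕ.+ j))) C k)))

Nr≡n+r*½ : ∀ r n → Nr r n ≡ ℕ→ℚ n + ℕ→ℚ r * ½
Nr≡n+r*½ r n = begin
  (ℤ.+ (2 ℕ.* n ℕ.+ r)) / 2
    ≡⟨ m/2≡m*½ (2 ℕ.* n ℕ.+ r) ⟩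
  ℕ→ℚ (2 ℕ.* n ℕ.+ r) * ½
    ≡⟨ cong (_* ½) (trans (ℕ→ℚ-+ (2 ℕ.* n) r) (cong (_+ ℕ→ℚ r) (ℕ→ℚ-* 2 n))) ⟩
  (ℕ→ℚ 2 * ℕ→ℚ n + ℕ→ℚ r) * ½
    ≡⟨ solve 2 (λ n r → (con (ℕ→ℚ 2) :* n :+ r) :* con ½ := n :+ r :* con ½) refl (ℕ→ℚ n) (ℕ→ℚ r) ⟩
  ℕ→ℚ n + ℕ→ℚ r * ½ ∎

-- H r N s is the leading s × s block of H∞ r N.
H∞ : ℕ → ℚ → ℕ → ℕ → ℚ
H∞ r N a b = hEntry r N (suc a) (suc b)

H∞-super : ℕ → ℕ → ℚ
H∞-super r a = ℕ→ℚ (r ℕ.+ suc a ℕ.+ 1)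

H∞-rowValue : ∀ r n w → rowValue (H∞ r (Nr r n)) (H∞-super r) (λ b → Sℚ (suc b) r n) w ≡ 0ℚ
H∞-rowValue r n w = begin
  ∑ w f + f w + H∞-super r w * X
    ≡⟨ cong₂ (λ u v → u + v + H∞-super r w * X) lower diagonal ⟩
  R * lowerSum w r n + (- (W * (ν + R * ½))) * Y + H∞-super r w * X
    ≡⟨ cong (λ c → R * lowerSum w r n + (- (W * (ν + R * ½))) * Y + c * X) super ⟩
  R * lowerSum w r n + (- (W * (ν + R * ½))) * Y + (R + W) * X
    ≡⟨ solve 6 (λ R W ν E Y X → R :* E :+ (:- (W :* (ν :+ R :* con ½))) :* Y :+ (R :+ W) :* X
                               := R :* E :- W :* (ν :+ R :* con ½) :* Y :+ (R :+ W) :* X)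
               refl R W ν (lowerSum w r n) Y X ⟩
  rowForm R W ν (lowerSum w r n) Y X
    ≡⟨ rowIdentity r w n ⟩
  0ℚ ∎
  where
  R = ℕ→ℚ r
  W = ℕ→ℚ (2 ℕ.+ w)
  ν = ℕ→ℚ n
  X = Sℚ (2 ℕ.+ w) r n
  Y = Sℚ (suc w) r n
  f = λ b → H∞ r (Nr r n) w b * Sℚ (suc b) r n
  lower : ∑ w f ≡ R * lowerSum w r n
  lower = trans (∑-cong-< w (λ b b<w → trans (cong (_* Sℚ (suc b) r n) (hEntry-below r (Nr r n) (s≤s b<w)))
                                             (solve 4 (λ R c β S → R :* c :* β :* S := R :* (c :* β :* S)) refl
                                                      R (Cℚ (2 ℕ.+ w) (suc b)) (B (suc w ∸ b)) (Sℚ (suc b) r n))))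
                (sym (*-distribˡ-∑ R _ w))
  diagonal : f w ≡ (- (W * (ν + R * ½))) * Y
  diagonal = trans (cong (_* Y) (hEntry-diagonal r (Nr r n) (suc w))) (cong (λ N → (- (W * N)) * Y) (Nr≡n+r*½ r n))
  super : H∞-super r w ≡ R + W
  super = trans (cong ℕ→ℚ (trans (ℕP.+-assoc r (suc w) 1) (cong (r ℕ.+_) (ℕP.+-comm (suc w) 1))))
                (ℕ→ℚ-+ r (2 ℕ.+ w))

rising-suc : ∀ x k → rising x (suc k) ≡ x ℕ.* rising (suc x) k
rising-suc x zero    = trans (ℕP.+-identityʳ (x ℕ.+ 0)) (trans (ℕP.+-identityʳ x) (sym (ℕP.*-identityʳ x)))
rising-suc x (suc k) rewrite rising-suc x k | ℕP.+-suc x k = ℕP.*-assoc x (rising (suc x) k) (suc (x ℕ.+ k))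

∏-ℕ→ℚ-+ : ∀ k x → ∏ k (λ t → ℕ→ℚ (x ℕ.+ t)) ≡ ℕ→ℚ (rising x k)
∏-ℕ→ℚ-+ zero    x = refl
∏-ℕ→ℚ-+ (suc k) x = begin
  ℕ→ℚ (x ℕ.+ 0) * ∏ k (λ t → ℕ→ℚ (x ℕ.+ suc t))
    ≡⟨ cong₂ _*_ (cong ℕ→ℚ (ℕP.+-identityʳ x))
                 (trans (∏-cong k (λ t → cong ℕ→ℚ (ℕP.+-suc x t))) (∏-ℕ→ℚ-+ k (suc x))) ⟩
  ℕ→ℚ x * ℕ→ℚ (rising (suc x) k)
    ≡⟨ ℕ→ℚ-* x (rising (suc x) k) ⟨
  ℕ→ℚ (x ℕ.* rising (suc x) k)
    ≡⟨ cong ℕ→ℚ (rising-suc x k) ⟨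
  ℕ→ℚ (rising x (suc k)) ∎

∏-H∞-super : ∀ r s → ∏ s (H∞-super r) ≡ ℕ→ℚ (rising (2 ℕ.+ r) s)
∏-H∞-super r s =
  trans (∏-cong s (λ a → cong ℕ→ℚ (trans (cong (ℕ._+ 1) (ℕP.+-suc r a)) (ℕP.+-comm (suc (r ℕ.+ a)) 1))))
        (∏-ℕ→ℚ-+ s (2 ℕ.+ r))

det-H : ∀ r n s → det s (H r (Nr r n) s) * Sℚ 1 r n ≡ negOnePow s * ℕ→ℚ (rising (2 ℕ.+ r) s) * Sℚ (suc s) r n
det-H r n s = begin
  det s (toMatrix s (H∞ r N)) * Sℚ 1 r n
    ≡⟨ det-hessenberg s (H∞ r N) (H∞-super r) (λ b → Sℚ (suc b) r n)
                      (λ a b a+1<b → hEntry-above r N (s≤s a+1<b)) (λ a → hEntry-super r N (suc a))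
                      (H∞-rowValue r n) ⟩
  negOnePow s * ∏ s (H∞-super r) * Sℚ (suc s) r n
    ≡⟨ cong (λ x → negOnePow s * x * Sℚ (suc s) r n) (∏-H∞-super r s) ⟩
  negOnePow s * ℕ→ℚ (rising (2 ℕ.+ r) s) * Sℚ (suc s) r n ∎
  where N = Nr r n

negOnePow-square : ∀ k → negOnePow k * negOnePow k ≡ 1ℚ
negOnePow-square zero    = refl
negOnePow-square (suc k) =
  trans (solve 1 (λ σ → (:- σ) :* (:- σ) := σ :* σ) refl (negOnePow k)) (negOnePow-square k)

theorem4 : (r m n : ℕ) → 1 ≤ m → 1 ≤ n →
    ℕ→ℚ (hyperSum m r n)
      ≡ ℕ→ℚ (hyperSum 1 r n) * negOnePow (m ∸ 1)
          * _/_ (ℤ.+ 1) (rising (2 ℕ.+ r) (m ∸ 1)) {{rising-nonZero (suc r) (m ∸ 1)}}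
          * det (m ∸ 1) (H r (Nr r n) (m ∸ 1))
theorem4 r (suc m) n _ _ = begin
  Sₘ
    ≡⟨ solve 1 (λ S → S := con 1ℚ :* con 1ℚ :* S) refl Sₘ ⟩
  1ℚ * 1ℚ * Sₘ
    ≡⟨ cong₂ (λ x y → x * y * Sₘ) (negOnePow-square m)
             (1/n*n≡1 (rising (2 ℕ.+ r) m) {{rising-nonZero (suc r) m}}) ⟨
  (σ * σ) * (ρ⁻¹ * ρ) * Sₘ
    ≡⟨ solve 4 (λ σ ρ⁻¹ ρ S → (σ :* σ) :* (ρ⁻¹ :* ρ) :* S := σ :* ρ⁻¹ :* (σ :* ρ :* S))
               refl σ ρ⁻¹ ρ Sₘ ⟩
  σ * ρ⁻¹ * (σ * ρ * Sₘ)
    ≡⟨ cong (σ * ρ⁻¹ *_) (det-H r n m) ⟨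
  σ * ρ⁻¹ * (D * S₁)
    ≡⟨ solve 4 (λ σ ρ⁻¹ D S → σ :* ρ⁻¹ :* (D :* S) := S :* σ :* ρ⁻¹ :* D) refl σ ρ⁻¹ D S₁ ⟩
  S₁ * σ * ρ⁻¹ * D ∎
  where
  Sₘ  = Sℚ (suc m) r n
  S₁  = Sℚ 1 r n
  σ   = negOnePow m
  ρ   = ℕ→ℚ (rising (2 ℕ.+ r) m)
  ρ⁻¹ = _/_ (ℤ.+ 1) (rising (2 ℕ.+ r) m) {{rising-nonZero (suc r) m}}
  D   = det m (H r (Nr r n) m)
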